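{- Let $k, b, n$ be positive integers satisfying $2(k+b)\leq n$. If $k+b+1$ distinct intervals of length $k$ are given in $\mathbb{Z}_n$, then there are two of them whose distance is at least $b+1$.
   Context: For $u,v\in\mathbb{Z}_n$ the distance $d(u,v)$ is the distance along the cycle, i.e. the smaller of the two values $(u-v)\bmod n$ and $(v-u)\bmod n$. An interval of length $a$ in $\mathbb{Z}_n$ is a set of the form $\{i+1,i+2,\ldots,i+a\}$ (mod $n$). The distance of two intervals is the minimum of $d(u,v)$ over $u$ in the first interval and $v$ in the second. -}

module Defs where

open import Data.Nat using (ℕ; _+_; _∸_; _<_; _≤_; _⊓_; NonZero)
open import Data.Nat.DivMod using (_%_)
open import Data.Product using (Σ; _×_; ∃)
open import Relation.Nullary using (¬_)
open import Relation.Binary.PropositionalEquality using (_≡_)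

-- Elements of ℤ_n are represented by residues u < n.

dist : (n : ℕ) → .{{_ : NonZero n}} → ℕ → ℕ → ℕ
dist n u v = ((u + n ∸ v) % n) ⊓ ((v + n ∸ u) % n)

InInterval : (n : ℕ) → .{{_ : NonZero n}} → (a i u : ℕ) → Set
InInterval n a i u = u < n × Σ ℕ (λ j → (1 ≤ j × j ≤ a) × u ≡ (i + j) % n)

SameInterval : (n : ℕ) → .{{_ : NonZero n}} → (a i i' : ℕ) → Set
SameInterval n a i i' = ∀ u → (InInterval n a i u → InInterval n a i' u)
                              × (InInterval n a i' u → InInterval n a i u)

IntervalDistAtLeast : (n : ℕ) → .{{_ : NonZero n}} → (a i i' m : ℕ) → Set
IntervalDistAtLeast n a i i' m =
  ∀ u v → InInterval n a i u → InInterval n a i' v → m ≤ dist n u v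

-- Measure every start relative to the first one, x₀, by its offset d ∈ [0, n).
-- Two intervals of length k whose offsets differ by some D with k + b ≤ D ≤ n − (k + b)
-- are at distance ≥ b + 1. If some offset lies in [k + b, n − (k + b)], pair it with x₀.
-- Otherwise all k + b + 1 offsets lie in [0, k + b) ∪ (n − (k + b), n); folding the second
-- block onto the first by subtracting L = n − (k + b) and applying the pigeonhole principle
-- yields two offsets that differ by exactly L, and k + b ≤ L since 2(k + b) ≤ n.
module Submission where

open import Defs
open import Data.Nat using (ℕ; suc; _+_; _*_; _∸_; _⊓_; _<_; _≤_; NonZero; z≤n; s≤s; _≤?_)
open import Data.Nat.Properties
open import Data.Nat.DivMod using (_%_; %-distribˡ-+; m%n%n≡m%n; m<n⇒m%n≡m; [m+n]%n≡m%n; n%n≡0; m%n<n)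
open import Data.Nat.Tactic.RingSolver using (solve)
open import Algebra.Properties.CommutativeSemigroup +-commutativeSemigroup using (x∙yz≈y∙xz; xy∙z≈xz∙y)
open import Data.Fin using (Fin) renaming (zero to fzero)
open import Data.Fin.Properties using (any?; pigeonhole; toℕ-fromℕ<) renaming (<⇒≢ to <⇒≢ᶠ)
import Data.Fin as Fin
open import Data.List using ([]; _∷_)
open import Data.Product using (Σ; ∃; _×_; _,_)
open import Data.Sum using (_⊎_; inj₁; inj₂)
open import Relation.Nullary using (¬_; Dec; yes; no; contradiction)
open import Relation.Nullary.Decidable using (_×-dec_)
open import Relation.Binary.PropositionalEquality
  using (_≡_; _≢_; refl; sym; trans; cong; cong₂; subst; subst₂; module ≡-Reasoning)

module _ {n : ℕ} .{{_ : NonZero n}} where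

  [m%n+o]%n≡[m+o]%n : ∀ m o → (m % n + o) % n ≡ (m + o) % n
  [m%n+o]%n≡[m+o]%n m o = begin
    (m % n + o) % n           ≡⟨ %-distribˡ-+ (m % n) o n ⟩
    (m % n % n + o % n) % n   ≡⟨ cong (λ t → (t + o % n) % n) (m%n%n≡m%n m n) ⟩
    (m % n + o % n) % n       ≡⟨ %-distribˡ-+ m o n ⟨
    (m + o) % n               ∎
    where open ≡-Reasoning

  [[x+d]%n+e]%n≡[x+[d+e]]%n : ∀ x d e → ((x + d) % n + e) % n ≡ (x + (d + e)) % n
  [[x+d]%n+e]%n≡[x+[d+e]]%n x d e =
    trans ([m%n+o]%n≡[m+o]%n (x + d) e) (cong (_% n) (+-assoc x d e))

  [x+n]%n≡x : ∀ {x} → x < n → (x + n) % n ≡ x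
  [x+n]%n≡x {x} x<n = trans ([m+n]%n≡m%n x n) (m<n⇒m%n≡m x<n)

  -- The residue d ∈ [0, n) with x + d ≡ y (mod n); dist n u v is offset v u ⊓ offset u v.
  offset : ℕ → ℕ → ℕ
  offset x y = (y + n ∸ x) % n

  offset<n : ∀ x y → offset x y < n
  offset<n x y = m%n<n (y + n ∸ x) n

  offset-self : ∀ x → offset x x ≡ 0
  offset-self x = trans (cong (_% n) (m+n∸m≡n x n)) (n%n≡0 n)

  +-offset : ∀ {x y} → x ≤ n → y < n → (x + offset x y) % n ≡ y
  +-offset {x} {y} x≤n y<n = begin
    (x + (y + n ∸ x) % n) % n   ≡⟨ cong (_% n) (+-comm x _) ⟩
    ((y + n ∸ x) % n + x) % n   ≡⟨ [m%n+o]%n≡[m+o]%n (y + n ∸ x) x ⟩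
    (y + n ∸ x + x) % n         ≡⟨ cong (_% n) (m∸n+n≡m (≤-trans x≤n (m≤n+m n y))) ⟩
    (y + n) % n                 ≡⟨ [x+n]%n≡x y<n ⟩
    y                           ∎
    where open ≡-Reasoning

  offset-+ : ∀ {x d} → x ≤ n → d < n → offset x ((x + d) % n) ≡ d
  offset-+ {x} {d} x≤n d<n = begin
    ((x + d) % n + n ∸ x) % n     ≡⟨ cong (_% n) (+-∸-assoc ((x + d) % n) x≤n) ⟩
    ((x + d) % n + (n ∸ x)) % n   ≡⟨ [[x+d]%n+e]%n≡[x+[d+e]]%n x d (n ∸ x) ⟩
    (x + (d + (n ∸ x))) % n       ≡⟨ cong (_% n) (x∙yz≈y∙xz x d (n ∸ x)) ⟩
    (d + (x + (n ∸ x))) % n       ≡⟨ cong (λ t → (d + t) % n) (m+[n∸m]≡n x≤n) ⟩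
    (d + n) % n                   ≡⟨ [x+n]%n≡x d<n ⟩
    d                             ∎
    where open ≡-Reasoning

  offset-injective : ∀ {x y z} → x ≤ n → y < n → z < n → offset x y ≡ offset x z → y ≡ z
  offset-injective {x} x≤n y<n z<n eq =
    trans (sym (+-offset x≤n y<n)) (trans (cong (λ t → (x + t) % n) eq) (+-offset x≤n z<n))

  offset-shift : ∀ {x y z e} → x ≤ n → y < n → z < n → offset x z ≡ offset x y + e → (y + e) % n ≡ z
  offset-shift {x} {y} {z} {e} x≤n y<n z<n z≡y+e = begin
    (y + e) % n                      ≡⟨ cong (λ t → (t + e) % n) (+-offset x≤n y<n) ⟨
    ((x + offset x y) % n + e) % n   ≡⟨ [[x+d]%n+e]%n≡[x+[d+e]]%n x (offset x y) e ⟩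
    (x + (offset x y + e)) % n       ≡⟨ cong (λ t → (x + t) % n) z≡y+e ⟨
    (x + offset x z) % n             ≡⟨ +-offset x≤n z<n ⟩
    z                                ∎
    where open ≡-Reasoning

  dist-+ : ∀ {u d} → u < n → 0 < d → d < n → dist n u ((u + d) % n) ≡ (n ∸ d) ⊓ d
  dist-+ {u} {d} u<n 0<d d<n = cong₂ _⊓_ (trans (cong (offset v) u≡v+[n∸d]) (offset-+ v≤n n∸d<n))
                                         (offset-+ (<⇒≤ u<n) d<n)
    where
      v = (u + d) % n
      v≤n = <⇒≤ (m%n<n (u + d) n)
      n∸d<n = ∸-monoʳ-< 0<d (<⇒≤ d<n)
      u≡v+[n∸d] : u ≡ (v + (n ∸ d)) % n
      u≡v+[n∸d] = sym (begin
        ((u + d) % n + (n ∸ d)) % n   ≡⟨ [[x+d]%n+e]%n≡[x+[d+e]]%n u d (n ∸ d) ⟩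
        (u + (d + (n ∸ d))) % n       ≡⟨ cong (λ t → (u + t) % n) (m+[n∸m]≡n (<⇒≤ d<n)) ⟩
        (u + n) % n                   ≡⟨ [x+n]%n≡x u<n ⟩
        u                             ∎)
        where open ≡-Reasoning

  ≤-dist-+ : ∀ {c u d} → 0 < c → c ≤ d → d + c ≤ n → u < n → c ≤ dist n u ((u + d) % n)
  ≤-dist-+ {c} {u} {d} 0<c c≤d d+c≤n u<n =
    subst (c ≤_) (sym (dist-+ u<n (<-≤-trans 0<c c≤d) d<n)) (⊓-glb c≤n∸d c≤d)
    where
      d<n = <-≤-trans (m<m+n d 0<c) d+c≤n
      c≤n∸d = subst (_≤ n ∸ d) (m+n∸m≡n d c) (∸-monoˡ-≤ d d+c≤n)

  -- Points x + j and y + j' (1 ≤ j, j' ≤ k) are e := d + j' − j apart, and k + b ≤ d ≤ n − (k + b)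
  -- keeps b + 1 ≤ e ≤ n − (b + 1).
  shifted-intervals-far : ∀ k b {x y d} → k + b ≤ d → d + (k + b) ≤ n → (x + d) % n ≡ y →
                          IntervalDistAtLeast n k x y (suc b)
  shifted-intervals-far k b {x} {y} {d} k+b≤d d+k+b≤n x+d≡y
                        u v (u<n , j , (1≤j , j≤k) , u≡x+j) (_ , j' , (1≤j' , j'≤k) , v≡y+j') =
    subst (λ w → suc b ≤ dist n u w) (sym v≡u+e) (≤-dist-+ (s≤s z≤n) b<e e+b<n u<n)
    where
      e = d + j' ∸ j
      e+j≡d+j' : e + j ≡ d + j'
      e+j≡d+j' = m∸n+n≡m (≤-trans j≤k (≤-trans (m≤m+n k b) (≤-trans k+b≤d (m≤m+n d j'))))

      b<e : suc b ≤ e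
      b<e = +-cancelʳ-≤ j (suc b) e (begin
        suc b + j       ≤⟨ +-monoʳ-≤ (suc b) j≤k ⟩
        suc b + k       ≡⟨ solve (b ∷ k ∷ []) ⟩
        k + b + 1       ≤⟨ +-mono-≤ k+b≤d 1≤j' ⟩
        d + j'          ≡⟨ e+j≡d+j' ⟨
        e + j           ∎)
        where open ≤-Reasoning

      e+b<n : e + suc b ≤ n
      e+b<n = +-cancelʳ-≤ j (e + suc b) n (begin
        e + suc b + j       ≡⟨ xy∙z≈xz∙y e (suc b) j ⟩
        e + j + suc b       ≡⟨ cong (_+ suc b) e+j≡d+j' ⟩
        d + j' + suc b      ≤⟨ +-monoˡ-≤ (suc b) (+-monoʳ-≤ d j'≤k) ⟩
        d + k + suc b       ≡⟨ solve (d ∷ k ∷ b ∷ []) ⟩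
        suc (d + (k + b))   ≤⟨ s≤s d+k+b≤n ⟩
        suc n               ≡⟨ +-comm 1 n ⟩
        n + 1               ≤⟨ +-monoʳ-≤ n 1≤j ⟩
        n + j               ∎)
        where open ≤-Reasoning

      v≡u+e : v ≡ (u + e) % n
      v≡u+e = begin
        v                         ≡⟨ v≡y+j' ⟩
        (y + j') % n              ≡⟨ cong (λ t → (t + j') % n) x+d≡y ⟨
        ((x + d) % n + j') % n    ≡⟨ [[x+d]%n+e]%n≡[x+[d+e]]%n x d j' ⟩
        (x + (d + j')) % n        ≡⟨ cong (λ t → (x + t) % n) (trans (+-comm j e) e+j≡d+j') ⟨
        (x + (j + e)) % n         ≡⟨ [[x+d]%n+e]%n≡[x+[d+e]]%n x j e ⟨
        ((x + j) % n + e) % n     ≡⟨ cong (λ t → (t + e) % n) u≡x+j ⟨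
        (u + e) % n               ∎
        where open ≡-Reasoning

fold : ℕ → ℕ → ℕ
fold L d with L ≤? d
... | yes _ = d ∸ L
... | no  _ = d

fold-cases : ∀ L d → fold L d + L ≡ d ⊎ (d < L × fold L d ≡ d)
fold-cases L d with L ≤? d
... | yes L≤d = inj₁ (m∸n+n≡m L≤d)
... | no  L≰d = inj₂ (≰⇒> L≰d , refl)

fold<m : ∀ {L m d} → d < L + m → d < m ⊎ L < d → fold L d < m
fold<m {L} {m} {d} d<L+m d<m⊎L<d with fold-cases L d | d<m⊎L<d
... | inj₁ f+L≡d     | _         = +-cancelʳ-< L (fold L d) m
                                     (subst₂ _<_ (sym f+L≡d) (+-comm L m) d<L+m)
... | inj₂ (_ , f≡d) | inj₁ d<m  = subst (_< m) (sym f≡d) d<m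
... | inj₂ (d<L , _) | inj₂ L<d  = contradiction d<L (<-asym L<d)

fold-injective-up-to-shift : ∀ L {d e} → fold L d ≡ fold L e → d ≡ e ⊎ e ≡ d + L ⊎ d ≡ e + L
fold-injective-up-to-shift L {d} {e} same with fold-cases L d | fold-cases L e
... | inj₁ fd+L≡d     | inj₁ fe+L≡e     = inj₁ (trans (sym fd+L≡d) (trans (cong (_+ L) same) fe+L≡e))
... | inj₂ (_ , fd≡d) | inj₂ (_ , fe≡e) = inj₁ (trans (sym fd≡d) (trans same fe≡e))
... | inj₂ (_ , fd≡d) | inj₁ fe+L≡e     = inj₂ (inj₁ (trans (sym fe+L≡e) (cong (_+ L) (trans (sym same) fd≡d))))
... | inj₁ fd+L≡d     | inj₂ (_ , fe≡e) = inj₂ (inj₂ (trans (sym fd+L≡d) (cong (_+ L) (trans same fe≡e))))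

fold-collision : ∀ {m} L (D : Fin (suc m) → ℕ) → (∀ p → D p < L + m) → (∀ p → D p < m ⊎ L < D p) →
                 (∀ i j → D i ≡ D j → i ≡ j) → ∃ λ i → ∃ λ j → i ≢ j × D j ≡ D i + L
fold-collision {m} L D D<L+m ends injective
  with i , j , i<j , same ← pigeonhole (n<1+n m) (λ p → Fin.fromℕ< (fold<m (D<L+m p) (ends p)))
  with fold-injective-up-to-shift L (trans (sym (toℕ-fromℕ< _)) (trans (cong Fin.toℕ same) (toℕ-fromℕ< _)))
... | inj₁ Di≡Dj        = contradiction (injective i j Di≡Dj) (<⇒≢ᶠ i<j)
... | inj₂ (inj₁ shift) = i , j , <⇒≢ᶠ i<j , shift
... | inj₂ (inj₂ shift) = j , i , (λ j≡i → <⇒≢ᶠ i<j (sym j≡i)) , shift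

sameInterval : ∀ {n} .{{_ : NonZero n}} {k x y} → x ≡ y → SameInterval n k x y
sameInterval refl _ = (λ u∈x → u∈x) , (λ u∈y → u∈y)

¬between⇒<⊎∸< : ∀ {m n d} → m ≤ n → ¬ (m ≤ d × d + m ≤ n) → d < m ⊎ n ∸ m < d
¬between⇒<⊎∸< {m} {n} {d} m≤n ¬between with m ≤? d
... | no  m≰d = inj₁ (≰⇒> m≰d)
... | yes m≤d = inj₂ (subst (n ∸ m <_) (m+n∸n≡m d m)
                             (∸-monoˡ-< (≰⇒> (λ d+m≤n → ¬between (m≤d , d+m≤n))) m≤n))

lemma2 : (k b n : ℕ) → .{{_ : NonZero n}} → 1 ≤ k → 1 ≤ b → 2 * (k + b) ≤ n →
    (start : Fin (suc (k + b)) → ℕ) → (∀ p → start p < n) →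
    (∀ p q → SameInterval n k (start p) (start q) → p ≡ q) →
    Σ (Fin (suc (k + b))) (λ p → Σ (Fin (suc (k + b))) (λ q →
      ¬ (p ≡ q) × IntervalDistAtLeast n k (start p) (start q) (suc b)))
lemma2 k b n 1≤k _ 2m≤n start start<n distinct = farPair (any? far?)
  where
    m = k + b
    L = n ∸ m
    x₀ = start fzero

    x₀≤n : x₀ ≤ n
    x₀≤n = <⇒≤ (start<n fzero)

    m≤n : m ≤ n
    m≤n = m+n≤o⇒m≤o m 2m≤n

    m≤L : m ≤ L
    m≤L = m+n≤o⇒m≤o∸n m (subst (_≤ n) (cong (m +_) (+-identityʳ m)) 2m≤n)

    L+m≡n : L + m ≡ n
    L+m≡n = m∸n+n≡m m≤n

    D : Fin (suc m) → ℕ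
    D p = offset x₀ (start p)

    far? : ∀ p → Dec (m ≤ D p × D p + m ≤ n)
    far? p = m ≤? D p ×-dec D p + m ≤? n

    D<L+m : ∀ p → D p < L + m
    D<L+m p = subst (D p <_) (sym L+m≡n) (offset<n x₀ (start p))

    D-injective : ∀ p q → D p ≡ D q → p ≡ q
    D-injective p q Dp≡Dq =
      distinct p q (sameInterval (offset-injective x₀≤n (start<n p) (start<n q) Dp≡Dq))

    farPair : Dec (∃ λ p → m ≤ D p × D p + m ≤ n) →
              Σ (Fin (suc m)) (λ p → Σ (Fin (suc m)) (λ q →
                ¬ (p ≡ q) × IntervalDistAtLeast n k (start p) (start q) (suc b)))
    farPair (yes (p , m≤D , D+m≤n)) =
      fzero , p , (λ { refl → <⇒≱ (≤-trans 1≤k (m≤m+n k b)) (subst (m ≤_) (offset-self x₀) m≤D) }) ,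
      shifted-intervals-far k b m≤D D+m≤n (+-offset x₀≤n (start<n p))
    farPair (no noneFar)
      with i , j , i≢j , Dj≡Di+L ← fold-collision L D D<L+m (λ p → ¬between⇒<⊎∸< m≤n (λ far → noneFar (p , far))) D-injective
      = i , j , i≢j , shifted-intervals-far k b m≤L (≤-reflexive L+m≡n) (offset-shift x₀≤n (start<n i) (start<n j) Dj≡Di+L)
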